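{- Let $S(1), \dots, S(L)$ be $L$ distinct subsets of $\{1,\dots,N\}$ with $|S(\ell)| = 2$ for each $\ell$ and $\bigcup_{\ell=1}^L S(\ell) = \{1,\dots,N\}$. For $A \subseteq \{1,\dots,N\}$ define $\eta(A) = \bigcup_{\ell:\, S(\ell)\cap A \ne \emptyset} S(\ell)$, and let $\mathcal P = \{A : \eta(A) = A\}$. Let $A_1 \subseteq \{1,\dots,N\}$ have cardinality $1$, and define $A_{n+1} = \eta(A_n)$ for $n \ge 1$. Then there exists a smallest positive integer $K$ such that $A_K = \eta(A_K) = A_{K+1}$; moreover $K \ge 2$, and $A_K$ is minimal.
   Context: A nonempty set $A \in \mathcal P$ is called minimal if for every nonempty subset $B \subseteq A$ with $B \ne A$ we have $\eta(B) \ne B$ (i.e. no nonempty proper subset of $A$ belongs to $\mathcal P$). -}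

module Defs where

open import Data.Nat using (ℕ; zero; suc)
open import Data.Fin using (Fin)
open import Data.Fin.Subset using (Subset; _∩_; ⋃; Nonempty; _⊂_)
open import Data.Fin.Subset.Properties using (nonempty?)
open import Data.List using (List; map; filter; allFin)
open import Data.Product using (_×_)
open import Relation.Binary.PropositionalEquality using (_≡_; _≢_)

η : ∀ {N L} → (Fin L → Subset N) → Subset N → Subset N
η {N} {L} S A = ⋃ (map S (filter (λ ℓ → nonempty? (S ℓ ∩ A)) (allFin L)))

InP : ∀ {N L} → (Fin L → Subset N) → Subset N → Set
InP S A = η S A ≡ A

Minimal : ∀ {N L} → (Fin L → Subset N) → Subset N → Set
Minimal S A = Nonempty A × InP S A × (∀ B → Nonempty B → B ⊂ A → η S B ≢ B)

-- The sequence A₁, A₂, … (1-indexed; index 0 is a dummy copy of A₁ and never used):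
-- seq 1 = A₁, seq (n+1) = η (seq n) for n ≥ 1.
seq : ∀ {N L} → (Fin L → Subset N) → Subset N → ℕ → Subset N
seq S A₁ zero = A₁
seq S A₁ (suc zero) = A₁
seq S A₁ (suc (suc n)) = η S (seq S A₁ (suc n))

{-# OPTIONS --safe #-}
-- The operator η is monotone, and inflationary because the edges cover {1,…,N}, so the
-- sets A₁ ⊆ A₂ ⊆ … grow strictly until the first fixed point A_K, which exists since
-- their sizes are bounded by N. A nonempty fixed point contains a whole edge, so it has
-- at least two elements and K ≥ 2. A_K is the least η-closed set containing the point v
-- of A₁. Since edges are symmetric, for closed sets B ⊊ C the difference C ∖ B is closed
-- too; whichever of B and C ∖ B contains v contains all of C, so B cannot be a nonempty
-- proper closed subset of A_K.
module Submission where

open import Defs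
open import Data.Nat using (ℕ; zero; suc; _≤_; _<_; z≤n; s≤s; _+_)
open import Data.Nat.Properties
  using (≤-trans; ≤-refl; n≮n; <⇒≱; m<n⇒m<1+n; m<1+n⇒m<n∨m≡n; +-suc; +-identityʳ; suc-injective)
open import Data.Bool.Properties using () renaming (_≟_ to _≟ᵇ_)
open import Data.Fin using (Fin; zero; suc)
open import Data.Fin.Subset
  using (Subset; ⋃; ⊤; ⊥; ∣_∣; ⁅_⁆; _∈_; _∉_; _⊆_; _⊂_; _∩_; ∁; Nonempty; inside; outside)
open import Data.Fin.Subset.Properties
open import Data.List using (List; []; _∷_; map; filter; allFin)
open import Data.List.Membership.Propositional using () renaming (_∈_ to _∈ₗ_)
open import Data.List.Membership.Propositional.Properties
  using (∈-map⁻; ∈-map∘filter⁺; ∈-map∘filter⁻; ∈-allFin)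
open import Data.List.Relation.Unary.Any using (here; there)
open import Data.Product using (Σ; ∃; ∃₂; _×_; _,_; proj₂)
open import Data.Sum using (inj₁; inj₂)
open import Data.Vec using (_∷_; [])
open import Data.Vec.Properties using (≡-dec)
open import Function.Definitions using (Injective)
open import Relation.Nullary using (Dec; yes; no; contradiction)
open import Relation.Nullary.Decidable using (decidable-stable)
open import Relation.Binary.PropositionalEquality using (_≡_; _≢_; refl; sym; subst; cong)

_≟ˢ_ : ∀ {n} (p q : Subset n) → Dec (p ≡ q)
_≟ˢ_ = ≡-dec _≟ᵇ_

∣p∣≡0⇒p≡⊥ : ∀ {n} {p : Subset n} → ∣ p ∣ ≡ 0 → p ≡ ⊥
∣p∣≡0⇒p≡⊥ {p = []} _ = refl
∣p∣≡0⇒p≡⊥ {p = outside ∷ p} ∣p∣≡0 = cong (outside ∷_) (∣p∣≡0⇒p≡⊥ ∣p∣≡0)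

∣p∣≡1⇒p≡⁅x⁆ : ∀ {n} {p : Subset n} → ∣ p ∣ ≡ 1 → ∃ λ x → p ≡ ⁅ x ⁆
∣p∣≡1⇒p≡⁅x⁆ {p = inside ∷ p} ∣p∣≡1 = zero , cong (inside ∷_) (∣p∣≡0⇒p≡⊥ (suc-injective ∣p∣≡1))
∣p∣≡1⇒p≡⁅x⁆ {p = outside ∷ p} ∣p∣≡1 with ∣p∣≡1⇒p≡⁅x⁆ ∣p∣≡1
... | x , p≡⁅x⁆ = suc x , cong (outside ∷_) p≡⁅x⁆

x∈p⇒⁅x⁆⊆p : ∀ {n} {x : Fin n} {p : Subset n} → x ∈ p → ⁅ x ⁆ ⊆ p
x∈p⇒⁅x⁆⊆p {x = x} {p} x∈p y∈⁅x⁆ = subst (_∈ p) (sym (x∈⁅y⁆⇒x≡y x y∈⁅x⁆)) x∈p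

p⊆q∧p≢q⇒p⊂q : ∀ {n} {p q : Subset n} → p ⊆ q → p ≢ q → p ⊂ q
p⊆q∧p≢q⇒p⊂q {p = p} {q} p⊆q p≢q with nonempty? (q ∩ ∁ p)
... | yes (x , x∈q∩∁p) with x∈p∩q⁻ q (∁ p) x∈q∩∁p
...   | x∈q , x∈∁p = p⊆q , x , x∈q , x∈∁p⇒x∉p x∈∁p
p⊆q∧p≢q⇒p⊂q {p = p} {q} p⊆q p≢q | no q∩∁p-empty = contradiction (⊆-antisym p⊆q q⊆p) p≢q
  where
  q⊆p : q ⊆ p
  q⊆p {x} x∈q = decidable-stable (x ∈? p) λ x∉p → q∩∁p-empty (x , x∈p∩q⁺ (x∈q , x∉p⇒x∈∁p x∉p))

x∈⋃⁺ : ∀ {n} {x : Fin n} {p} (ps : List (Subset n)) → p ∈ₗ ps → x ∈ p → x ∈ ⋃ ps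
x∈⋃⁺ (p ∷ ps) (here refl) x∈p = x∈p∪q⁺ (inj₁ x∈p)
x∈⋃⁺ (q ∷ ps) (there p∈ps) x∈p = x∈p∪q⁺ (inj₂ (x∈⋃⁺ ps p∈ps x∈p))

x∈⋃⁻ : ∀ {n} {x : Fin n} (ps : List (Subset n)) → x ∈ ⋃ ps → ∃ λ p → p ∈ₗ ps × x ∈ p
x∈⋃⁻ [] x∈⊥ = contradiction x∈⊥ ∉⊥
x∈⋃⁻ (p ∷ ps) x∈p∪⋃ps with x∈p∪q⁻ p (⋃ ps) x∈p∪⋃ps
... | inj₁ x∈p = p , here refl , x∈p
... | inj₂ x∈⋃ps with x∈⋃⁻ ps x∈⋃ps
...   | q , q∈ps , x∈q = q , there q∈ps , x∈q

module _ {n : ℕ} (a : ℕ → Subset n) (increasing : ∀ j → a j ⊆ a (suc j)) where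

  StrictBelow : ℕ → Set
  StrictBelow k = ∀ j → j < k → a j ≢ a (suc j)

  strictBelow-suc : ∀ {k} → StrictBelow k → a k ≢ a (suc k) → StrictBelow (suc k)
  strictBelow-suc below a-k≢a-1+k j j<1+k with m<1+n⇒m<n∨m≡n j<1+k
  ... | inj₁ j<k = below j j<k
  ... | inj₂ refl = a-k≢a-1+k

  strictBelow⇒k≤∣a-k∣ : ∀ k → StrictBelow k → k ≤ ∣ a k ∣
  strictBelow⇒k≤∣a-k∣ zero _ = z≤n
  strictBelow⇒k≤∣a-k∣ (suc k) below =
    ≤-trans (s≤s (strictBelow⇒k≤∣a-k∣ k λ j j<k → below j (m<n⇒m<1+n j<k)))
            (p⊂q⇒∣p∣<∣q∣ (p⊆q∧p≢q⇒p⊂q (increasing k) (below k ≤-refl)))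

  first-stable : ∃ λ k → a k ≡ a (suc k) × StrictBelow k
  first-stable = search (suc n) 0 (λ _ ()) ≤-refl
    where
    search : ∀ fuel k → StrictBelow k → n < k + fuel → ∃ λ k → a k ≡ a (suc k) × StrictBelow k
    search fuel k below n<k+fuel with a k ≟ˢ a (suc k)
    ... | yes stable = k , stable , below
    search zero k below n<k | no _ =
      contradiction (≤-trans (strictBelow⇒k≤∣a-k∣ k below) (∣p∣≤n (a k)))
                    (<⇒≱ (subst (n <_) (+-identityʳ k) n<k))
    search (suc fuel) k below n<k+1+fuel | no unstable =
      search fuel (suc k) (strictBelow-suc below unstable) (subst (n <_) (+-suc k fuel) n<k+1+fuel)

Closed : ∀ {N L} → (Fin L → Subset N) → Subset N → Set
Closed S X = η S X ⊆ X

module _ {N L : ℕ} (S : Fin L → Subset N) where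

  meets? : (A : Subset N) (ℓ : Fin L) → Dec (Nonempty (S ℓ ∩ A))
  meets? A ℓ = nonempty? (S ℓ ∩ A)

  x∈η⁺ : ∀ {A ℓ x z} → z ∈ S ℓ → z ∈ A → x ∈ S ℓ → x ∈ η S A
  x∈η⁺ {A} {ℓ} {z = z} z∈Sℓ z∈A =
    x∈⋃⁺ (map S (filter (meets? A) (allFin L)))
      (∈-map∘filter⁺ S (meets? A) {f = S} {xs = allFin L}
        (ℓ , ∈-allFin ℓ , refl , z , x∈p∩q⁺ (z∈Sℓ , z∈A)))

  x∈η⁻ : ∀ {A x} → x ∈ η S A → ∃₂ λ ℓ z → x ∈ S ℓ × z ∈ S ℓ × z ∈ A
  x∈η⁻ {A} x∈ηA with x∈⋃⁻ (map S (filter (meets? A) (allFin L))) x∈ηA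
  ... | p , p∈edges , x∈p with ∈-map∘filter⁻ S (meets? A) {f = S} {xs = allFin L} p∈edges
  ...   | ℓ , _ , refl , z , z∈Sℓ∩A = ℓ , z , x∈p , x∈p∩q⁻ (S ℓ) A z∈Sℓ∩A

  η-mono : ∀ {A B} → A ⊆ B → η S A ⊆ η S B
  η-mono A⊆B x∈ηA with x∈η⁻ x∈ηA
  ... | ℓ , z , x∈Sℓ , z∈Sℓ , z∈A = x∈η⁺ z∈Sℓ (A⊆B z∈A) x∈Sℓ

  fixed⇒Closed : ∀ {X} → InP S X → Closed S X
  fixed⇒Closed ηX≡X x∈ηX = subst (_ ∈_) ηX≡X x∈ηX

  -- An edge meeting the closed set B lies inside B, so an edge meeting C ∖ B avoids B.
  Closed-∩∁ : ∀ {B C} → Closed S B → Closed S C → Closed S (C ∩ ∁ B)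
  Closed-∩∁ {B} {C} B-closed C-closed {y} y∈η with x∈η⁻ y∈η
  ... | ℓ , z , y∈Sℓ , z∈Sℓ , z∈C∖B with x∈p∩q⁻ C (∁ B) z∈C∖B
  ...   | z∈C , z∈∁B = x∈p∩q⁺ (C-closed (x∈η⁺ z∈Sℓ z∈C y∈Sℓ) , x∉p⇒x∈∁p y∉B)
    where
    y∉B : y ∉ B
    y∉B y∈B = x∈∁p⇒x∉p z∈∁B (B-closed (x∈η⁺ y∈Sℓ y∈B z∈Sℓ))

  least-closed⇒Minimal : ∀ {C v} → InP S C → v ∈ C →
    (∀ X → Closed S X → v ∈ X → C ⊆ X) → Minimal S C
  least-closed⇒Minimal {C} {v} C-fixed v∈C least = (v , v∈C) , C-fixed , no-smaller
    where
    no-smaller : ∀ B → Nonempty B → B ⊂ C → η S B ≢ B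
    no-smaller B (u , u∈B) (B⊆C , x , x∈C , x∉B) B-fixed with v ∈? B
    ... | yes v∈B = x∉B (least B (fixed⇒Closed B-fixed) v∈B x∈C)
    ... | no v∉B = x∈∁p⇒x∉p (proj₂ (x∈p∩q⁻ C (∁ B) (least (C ∩ ∁ B) C∖B-closed v∈C∖B (B⊆C u∈B)))) u∈B
      where
      C∖B-closed : Closed S (C ∩ ∁ B)
      C∖B-closed = Closed-∩∁ (fixed⇒Closed B-fixed) (fixed⇒Closed C-fixed)
      v∈C∖B : v ∈ C ∩ ∁ B
      v∈C∖B = x∈p∩q⁺ (v∈C , x∉p⇒x∈∁p v∉B)

  seq-least : ∀ {A₁ X} → Closed S X → A₁ ⊆ X → ∀ m → seq S A₁ (suc m) ⊆ X
  seq-least X-closed A₁⊆X zero = A₁⊆X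
  seq-least X-closed A₁⊆X (suc m) x∈η = X-closed (η-mono (seq-least X-closed A₁⊆X m) x∈η)

module _ {N L : ℕ} (S : Fin L → Subset N) (cover : ⋃ (map S (allFin L)) ≡ ⊤) where

  covered : ∀ x → ∃ λ ℓ → x ∈ S ℓ
  covered x with x∈⋃⁻ (map S (allFin L)) (subst (x ∈_) (sym cover) ∈⊤)
  ... | p , p∈edges , x∈p with ∈-map⁻ S p∈edges
  ...   | ℓ , _ , refl = ℓ , x∈p

  η-inflationary : ∀ {A} → A ⊆ η S A
  η-inflationary {x = x} x∈A with covered x
  ... | ℓ , x∈Sℓ = x∈η⁺ S x∈Sℓ x∈A x∈Sℓ

  seq-inflationary : ∀ {A₁} m → A₁ ⊆ seq S A₁ (suc m)
  seq-inflationary zero x∈A₁ = x∈A₁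
  seq-inflationary (suc m) x∈A₁ = η-inflationary (seq-inflationary m x∈A₁)

  seq-fixed⇒Minimal : ∀ {v} m → InP S (seq S ⁅ v ⁆ (suc m)) → Minimal S (seq S ⁅ v ⁆ (suc m))
  seq-fixed⇒Minimal {v} m fixed =
    least-closed⇒Minimal S fixed (seq-inflationary m (x∈⁅x⁆ v))
      λ X X-closed v∈X → seq-least S X-closed (x∈p⇒⁅x⁆⊆p v∈X) m

  2≤∣fixed∣ : (∀ ℓ → ∣ S ℓ ∣ ≡ 2) → ∀ {A x} → InP S A → x ∈ A → 2 ≤ ∣ A ∣
  2≤∣fixed∣ pairs {A} {x} A-fixed x∈A with covered x
  ... | ℓ , x∈Sℓ =
    subst (_≤ ∣ A ∣) (pairs ℓ)
      (p⊆q⇒∣p∣≤∣q∣ λ y∈Sℓ → fixed⇒Closed S A-fixed (x∈η⁺ S x∈Sℓ x∈A y∈Sℓ))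

lemma3p3 : (N L : ℕ) (S : Fin L → Subset N) →
    Injective _≡_ _≡_ S →
    (∀ ℓ → ∣ S ℓ ∣ ≡ 2) →
    ⋃ (map S (allFin L)) ≡ ⊤ →
    (A₁ : Subset N) → ∣ A₁ ∣ ≡ 1 →
    Σ ℕ (λ K →
      (1 ≤ K
        × seq S A₁ K ≡ η S (seq S A₁ K)
        × η S (seq S A₁ K) ≡ seq S A₁ (suc K)
        × (∀ j → 1 ≤ j → j < K → seq S A₁ j ≢ η S (seq S A₁ j)))
      × 2 ≤ K
      × Minimal S (seq S A₁ K))
lemma3p3 N L S _ pairs cover A₁ ∣A₁∣≡1 with ∣p∣≡1⇒p≡⁅x⁆ {p = A₁} ∣A₁∣≡1
... | v , refl with first-stable (λ j → seq S ⁅ v ⁆ (suc j)) (λ _ → η-inflationary S cover)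
...   | zero , stable , _ =
  contradiction (subst (2 ≤_) ∣A₁∣≡1 (2≤∣fixed∣ S cover pairs (sym stable) (x∈⁅x⁆ v))) (n≮n 1)
...   | suc k , stable , below =
  suc (suc k) , (s≤s z≤n , stable , refl , shift) , s≤s (s≤s z≤n)
    , seq-fixed⇒Minimal S cover (suc k) (sym stable)
  where
  shift : ∀ j → 1 ≤ j → j < suc (suc k) → seq S ⁅ v ⁆ j ≢ η S (seq S ⁅ v ⁆ j)
  shift (suc j) _ (s≤s j<1+k) = below j j<1+k
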